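{- Let $X=\{a_1,\dots,a_{3n}\}$ be a set of distinct natural numbers with $\sum_i a_i=nB$ and $B/4<a_i<B/2$ for all $i$, and let $m$, $X'$, $B'$ and $IG(X)$ be as defined in the context. If $X'$ can be partitioned into $n$ sets of three elements each, each set summing to $B'$, then $b(IG(X))=2m+1$.
   Context: Let $m=\max(X)$, $X'=\{2a_i-1: a_i\in X\}$, $B'=2B-3$ (so $\sum_{x\in X'}x=nB'$), $F'_m=\{1,3,5,\dots,2m-1\}$, $Y=F'_m\setminus X'$ and $k=|Y|=m-3n$. Take paths $Q_1,\dots,Q_n$ each with $B'$ vertices; paths $Q'_1,\dots,Q'_k$ where $Q'_j$ has as many vertices as the $j$-th largest element of $Y$; and paths $T_1,\dots,T_{m+1}$ where $T_j$ has $2(2m+1-j)+1$ vertices. Joining two paths in a given order means adding an edge from the last vertex of the first to the first vertex of the second. Join the paths in the order $Q_1,T_1,Q_2,T_2,\dots,Q_n,T_n,Q'_1,T_{n+1},Q'_2,T_{n+2},\dots,Q'_k,T_{n+k},T_{n+k+1},\dots,T_{m+1}$ to obtain a path $P_I$ with $(2m+1)^2$ vertices. Then, for each $j$, attach to every vertex of $T_j$ other than its first and last vertex a new pendant vertex (a new vertex adjacent only to that vertex). The resulting graph is $IG(X)$ (it is an interval graph). Graph burning on $G$: in each round $t$, first a vertex $x_t$ is chosen as a fire source and becomes burnt, then every vertex adjacent to a vertex burnt by the end of round $t-1$ becomes burnt. A burning sequence $(x_1,\dots,x_k)$ is one with $\bigcup_{i=1}^k N_{k-i}[x_i]=V(G)$,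 $N_r[x]$ being the closed ball of radius $r$; $b(G)$ is the minimum length of a burning sequence. -}

module Defs where

open import Data.Nat using (ℕ; zero; suc; _+_; _*_; _∸_; _⊔_; _≤_; _<_)
open import Data.Nat.Properties using (_≟_)
open import Data.Bool using (Bool; true; false)
open import Data.Fin using (Fin; toℕ)
open import Data.List using (List; []; _∷_; map; foldr; filter; upTo; downFrom; replicate; _++_; concat; sum)
open import Data.List.Membership.DecPropositional _≟_ using (_∈?_)
open import Data.Vec using (Vec; lookup)
open import Data.Product using (Σ; ∃; _×_; _,_)
open import Data.Sum using (_⊎_)
open import Data.Empty using (⊥)
open import Data.Unit using (⊤)
open import Relation.Nullary.Decidable using (¬?)
open import Relation.Binary.PropositionalEquality using (_≡_)

record Graph : Set₁ where
  field
    V   : Set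
    Adj : V → V → Set

module _ (G : Graph) where
  open Graph G

  data Within : ℕ → V → V → Set where
    here : ∀ {r x} → Within r x x
    step : ∀ {r x y z} → Adj x y → Within r y z → Within (suc r) x z

  -- (x_1,…,x_k) is a burning sequence: ⋃_i N_{k-i}[x_i] = V(G)
  -- (with 0-based index i the radius is k - (i+1)).
  IsBurningSeq : (k : ℕ) → Vec V k → Set
  IsBurningSeq k xs = ∀ (v : V) → ∃ λ (i : Fin k) → Within (k ∸ suc (toℕ i)) (lookup xs i) v

  BurningNumberIs : ℕ → Set
  BurningNumberIs c =
    (Σ (Vec V c) λ xs → IsBurningSeq c xs)
    × (∀ (k : ℕ) (xs : Vec V k) → IsBurningSeq k xs → c ≤ k)

maxL : List ℕ → ℕ
maxL = foldr _⊔_ 0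

X′ : List ℕ → List ℕ
X′ X = map (λ a → 2 * a ∸ 1) X

-- Y = F'_m \ X', listed in decreasing order, where F'_m = {1,3,…,2m-1}
Ylist : List ℕ → List ℕ
Ylist X = filter (λ y → ¬? (y ∈? X′ X)) (map (λ i → 2 * i + 1) (downFrom (maxL X)))

-- vertex counts of T_1, …, T_{m+1}: T_j has 2(2m+1-j)+1 vertices
Tlens : ℕ → List ℕ
Tlens m = map (λ i → 2 * (2 * m ∸ i) + 1) (upTo (suc m))

-- interleave Q-paths (flag false) with T-paths (flag true): Q,T,Q,T,…,then remaining T's
interleave : List ℕ → List ℕ → List (ℕ × Bool)
interleave []       ts       = map (λ t → t , true) ts
interleave (q ∷ qs) []       = (q , false) ∷ interleave qs []
interleave (q ∷ qs) (t ∷ ts) = (q , false) ∷ (t , true) ∷ interleave qs ts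

-- segments of P_I in order: Q_1,T_1,…,Q_n,T_n,Q'_1,T_{n+1},…,Q'_k,T_{n+k},T_{n+k+1},…,T_{m+1}
-- (each Q_i has B' = 2B-3 vertices)
segments : ℕ → ℕ → List ℕ → List (ℕ × Bool)
segments n B X = interleave (replicate n (2 * B ∸ 3) ++ Ylist X) (Tlens (maxL X))

totalLen : List (ℕ × Bool) → ℕ
totalLen [] = 0
totalLen ((ℓ , _) ∷ ss) = ℓ + totalLen ss

-- InnerT s segs p : path vertex p (global position along P_I, where the
-- segment list starts at offset s) is a vertex of some T_j other than its
-- first and last vertex.
InnerT : ℕ → List (ℕ × Bool) → ℕ → Set
InnerT s [] p = ⊥
InnerT s ((ℓ , b) ∷ ss) p = (b ≡ true × s < p × suc p < s + ℓ) ⊎ InnerT (s + ℓ) ss p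

-- raw vertices: path vertices (positions 0,…,|P_I|-1) and pendant vertices
-- (pend p is the pendant attached to path vertex p)
data Vtx : Set where
  path : ℕ → Vtx
  pend : ℕ → Vtx

IsVtx : List (ℕ × Bool) → Vtx → Set
IsVtx segs (path p) = p < totalLen segs
IsVtx segs (pend p) = InnerT 0 segs p

AdjV : Vtx → Vtx → Set
AdjV (path p) (path q) = suc p ≡ q ⊎ suc q ≡ p
AdjV (path p) (pend q) = p ≡ q
AdjV (pend p) (path q) = p ≡ q
AdjV (pend p) (pend q) = ⊥

IG : ℕ → ℕ → List ℕ → Graph
IG n B X = record
  { V   = Σ Vtx (IsVtx (segments n B X))
  ; Adj = λ u v → AdjV (Σ.proj₁ u) (Σ.proj₁ v)
  }

flattenTriples : List (ℕ × ℕ × ℕ) → List ℕ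
flattenTriples [] = []
flattenTriples ((a , b , c) ∷ ts) = a ∷ b ∷ c ∷ flattenTriples ts

tripleSum : ℕ × ℕ × ℕ → ℕ
tripleSum (a , b , c) = a + b + c

-- A ball of radius r meets at most 2r + 1 vertices of the path P_I (a pendant lies at the position
-- of its path neighbour), so k sources cover at most 1 + 3 + ⋯ + (2k − 1) = k² of its (2m + 1)²
-- vertices, and b(IG(X)) ≥ 2m + 1. Conversely, the triples cut each Q_i into three subpaths with
-- lengths in X′, and X′ ∪ Y = {1, 3, …, 2m − 1} while the T_j have lengths 2m + 1, …, 4m + 1; so
-- P_I is cut into consecutive subpaths of lengths exactly 1, 3, …, 4m + 1. Burning the centre of
-- the piece with 2r + 1 vertices as the source of radius r covers that piece, and the pendants,
-- which hang on inner vertices of T-pieces only, are at distance at most r from that centre too.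
module Submission where

open import Defs
open import Data.Nat
  using (ℕ; zero; suc; _+_; _*_; _∸_; _⊓_; _≤_; _<_; z≤n; s≤s; s≤s⁻¹; _<?_; ⌊_/2⌋)
open import Data.Nat.Properties
open import Algebra.Properties.Monoid.Sum +-0-monoid using (sum-syntax)
open import Data.Bool using (Bool; true; false)
open import Data.Fin using (Fin; toℕ; fromℕ<; opposite) renaming (zero to fzero; suc to fsuc)
open import Data.Fin.Properties using (toℕ-fromℕ<; opposite-prop; opposite-involutive)
open import Data.List
  using (List; []; _∷_; _++_; [_]; length; map; concat; replicate; applyUpTo; downFrom)
open import Data.List.Properties
  using ( map-++; ++-assoc; concat-map; concat-++; concat-map-[_]
        ; map-upTo; map-applyUpTo; map-∘; map-id-local)
open import Data.List.Membership.Propositional using (_∈_)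
open import Data.List.Membership.DecPropositional _≟_ using (_∈?_)
open import Data.List.Membership.Propositional.Properties
  using (∈-map⁺; ∈-map⁻; ∈-++⁺ˡ; ∈-++⁺ʳ; ∈-++⁻; ∈-filter⁺; ∈-filter⁻; ∈-downFrom⁺; ∈-downFrom⁻)
open import Data.List.Membership.Propositional.Properties.WithK using (unique∧set⇒bag)
open import Data.List.Relation.Unary.Any using (here; there)
open import Data.List.Relation.Unary.All as All using (All; []; _∷_)
open import Data.List.Relation.Unary.All.Properties as All using ()
open import Data.List.Relation.Unary.AllPairs using (_∷_)
open import Data.List.Relation.Unary.Unique.Propositional using (Unique)
import Data.List.Relation.Unary.Unique.Propositional.Properties as Unique
open import Data.List.Relation.Binary.Pointwise as Pointwise using (Pointwise; []; _∷_)
open import Data.List.Relation.Binary.BagAndSetEquality using (∼bag⇒↭)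
open import Data.List.Relation.Binary.Permutation.Propositional
  using (_↭_; ↭-refl; ↭-sym; ↭⇒↭ₛ; prep; module PermutationReasoning)
open import Data.List.Relation.Binary.Permutation.Propositional.Properties as Perm
  using (++⁺ˡ; ++⁺ʳ; ++-comm; shift; All-resp-↭; ∈-resp-↭)
open import Data.Nat.ListAction using (sum)
open import Data.Nat.ListAction.Properties using (sum-++; sum-↭)
open import Data.Nat.Tactic.RingSolver using (solve-∀)
open import Data.Product using (Σ; ∃; ∃₂; _×_; _,_; proj₁; proj₂)
open import Data.Sum using (inj₁; inj₂)
open import Data.Vec using (Vec; toList; lookup; tabulate) renaming ([] to []ᵥ; _∷_ to _∷ᵥ_)
open import Data.Vec.Properties using (lookup∘tabulate)
open import Function using (_∘_; mk⇔)
open import Relation.Binary.Definitions using (Symmetric)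
open import Relation.Binary.PropositionalEquality hiding ([_])
open import Data.List.Relation.Binary.Permutation.Setoid.Properties (setoid ℕ) using (Unique-resp-↭)
open import Relation.Nullary using (yes; no; ¬?; contradiction)

radius-index : ∀ {K r} → r < K → ∃ λ (i : Fin K) → K ∸ suc (toℕ i) ≡ r
radius-index {K} {r} r<K = opposite j , (begin
  K ∸ suc (toℕ (opposite j))   ≡⟨ opposite-prop (opposite j) ⟨
  toℕ (opposite (opposite j))  ≡⟨ cong toℕ (opposite-involutive j) ⟩
  toℕ j                        ≡⟨ toℕ-fromℕ< r<K ⟩
  r                            ∎)
  where
  open ≡-Reasoning
  j = fromℕ< r<K

module _ {G : Graph} where
  open Graph G

  Within-snoc : ∀ {r x y z} → Within G r x y → Adj y z → Within G (suc r) x z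
  Within-snoc here       a = step a here
  Within-snoc (step b w) a = step b (Within-snoc w a)

  Within-sym : Symmetric Adj → ∀ {r x y} → Within G r x y → Within G r y x
  Within-sym sym-adj here       = here
  Within-sym sym-adj (step a w) = Within-snoc (Within-sym sym-adj w) (sym-adj a)

  burningSeq-from-radii : ∀ K (src : ∀ r → r < K → V) →
    (∀ v → ∃₂ λ r (r<K : r < K) → Within G r (src r r<K) v) →
    Σ (Vec V K) (IsBurningSeq G K)
  burningSeq-from-radii K src covers = tabulate source , burns
    where
    radius<K : ∀ {K} (i : Fin K) → K ∸ suc (toℕ i) < K
    radius<K {suc K} i = s≤s (m∸n≤m K (toℕ i))
    source : Fin K → V
    source i = src (K ∸ suc (toℕ i)) (radius<K i)
    burns : IsBurningSeq G K (tabulate source)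
    burns v with covers v
    ... | r , r<K , w with radius-index r<K
    ...   | i , refl = i , subst (λ x → Within G r x v) source≡ w
      where
      source≡ : src r r<K ≡ lookup (tabulate source) i
      source≡ = sym (trans (lookup∘tabulate source i) (cong (src r) (<-irrelevant _ _)))

odd : ℕ → ℕ
odd r = 2 * r + 1

square-suc : ∀ k → 2 * k + 1 + k * k ≡ suc k * suc k
square-suc = solve-∀

∑-odd : ∀ k → ∑[ i < k ] odd (k ∸ suc (toℕ i)) ≡ k * k
∑-odd zero    = refl
∑-odd (suc k) = trans (cong (odd k +_) (∑-odd k)) (square-suc k)

sum-odd-downFrom : ∀ k → sum (map odd (downFrom k)) ≡ k * k
sum-odd-downFrom zero    = refl
sum-odd-downFrom (suc k) = trans (cong (odd k +_) (sum-odd-downFrom k)) (square-suc k)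

∑-mono-≤ : ∀ {k} {f g : Fin k → ℕ} → (∀ i → f i ≤ g i) → ∑[ i < k ] f i ≤ ∑[ i < k ] g i
∑-mono-≤ {zero}  f≤g = z≤n
∑-mono-≤ {suc k} f≤g = +-mono-≤ (f≤g fzero) (∑-mono-≤ (f≤g ∘ fsuc))

∑-mono-< : ∀ {k} {f g : Fin k → ℕ} → (∀ i → f i ≤ g i) → ∀ j → f j < g j →
  ∑[ i < k ] f i < ∑[ i < k ] g i
∑-mono-< f≤g fzero    f<g = +-mono-<-≤ f<g (∑-mono-≤ (f≤g ∘ fsuc))
∑-mono-< f≤g (fsuc j) f<g = +-mono-≤-< (f≤g fzero) (∑-mono-< (f≤g ∘ fsuc) j f<g)

-- b i ⊓ N ∸ a i is the number of points of [0, N) in the interval [a i, b i).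
intervals-cover-≤ : ∀ {k} (a b : Fin k → ℕ) N →
  (∀ p → p < N → ∃ λ i → a i ≤ p × p < b i) → N ≤ ∑[ i < k ] (b i ⊓ N ∸ a i)
intervals-cover-≤ a b zero    cover = z≤n
intervals-cover-≤ a b (suc N) cover with cover N ≤-refl
... | j , aj≤N , N<bj = ≤-<-trans
        (intervals-cover-≤ a b N (λ p p<N → cover p (m<n⇒m<1+n p<N)))
        (∑-mono-< grows j grows-at-j)
  where
  grows : ∀ i → b i ⊓ N ∸ a i ≤ b i ⊓ suc N ∸ a i
  grows i = ∸-monoˡ-≤ (a i) (⊓-monoʳ-≤ (b i) (n≤1+n N))
  grows-at-j : b j ⊓ N ∸ a j < b j ⊓ suc N ∸ a j
  grows-at-j rewrite m≥n⇒m⊓n≡n (<⇒≤ N<bj) | m≥n⇒m⊓n≡n N<bj = ∸-monoˡ-< ≤-refl aj≤N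

-- Distances along a path with pendants

-- IG n B X is PendantPath (segments n B X) by definition.
PendantPath : List (ℕ × Bool) → Graph
PendantPath segs = record
  { V   = Σ Vtx (IsVtx segs)
  ; Adj = λ u v → AdjV (proj₁ u) (proj₁ v)
  }

AdjV-sym : ∀ {u v} → AdjV u v → AdjV v u
AdjV-sym {path _} {path _} (inj₁ e) = inj₂ e
AdjV-sym {path _} {path _} (inj₂ e) = inj₁ e
AdjV-sym {path _} {pend _} e        = sym e
AdjV-sym {pend _} {path _} e        = sym e

position : Vtx → ℕ
position (path p) = p
position (pend p) = p

Close : ℕ → ℕ → ℕ → Set
Close r x y = x ≤ y + r × y ≤ x + r

Close-refl : ∀ r x → Close r x x
Close-refl r x = m≤m+n x r , m≤m+n x r

Close-sym : ∀ {r x y} → Close r x y → Close r y x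
Close-sym (x≤y+r , y≤x+r) = y≤x+r , x≤y+r

Close-suc : ∀ p → Close 1 p (suc p)
Close-suc p = ≤-trans (n≤1+n p) (m≤m+n (suc p) 1) , ≤-reflexive (+-comm 1 p)

Close-trans : ∀ {r s x y z} → Close r x y → Close s y z → Close (r + s) x z
Close-trans {r} {s} {x} {y} {z} (x≤y+r , y≤x+r) (y≤z+s , z≤y+s) =
  (begin
    x            ≤⟨ x≤y+r ⟩
    y + r        ≤⟨ +-monoˡ-≤ r y≤z+s ⟩
    z + s + r    ≡⟨ +-assoc z s r ⟩
    z + (s + r)  ≡⟨ cong (z +_) (+-comm s r) ⟩
    z + (r + s)  ∎) ,
  (begin
    z            ≤⟨ z≤y+s ⟩
    y + s        ≤⟨ +-monoˡ-≤ s y≤x+r ⟩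
    x + r + s    ≡⟨ +-assoc x r s ⟩
    x + (r + s)  ∎)
  where open ≤-Reasoning

Close⇒∈interval : ∀ {r c p} → Close r c p → c ∸ r ≤ p × p < suc (c + r)
Close⇒∈interval {r} {c} {p} (c≤p+r , p≤c+r) =
  m≤n+o⇒m∸n≤o c r (≤-trans c≤p+r (≤-reflexive (+-comm p r))) , s≤s p≤c+r

AdjV⇒Close : ∀ u v → AdjV u v → Close 1 (position u) (position v)
AdjV⇒Close (path p) (path _) (inj₁ refl) = Close-suc p
AdjV⇒Close (path _) (path q) (inj₂ refl) = Close-sym (Close-suc q)
AdjV⇒Close (path p) (pend _) refl        = Close-refl 1 p
AdjV⇒Close (pend p) (path _) refl        = Close-refl 1 p

Within⇒Close : ∀ {segs r x y} → Within (PendantPath segs) r x y →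
  Close r (position (proj₁ x)) (position (proj₁ y))
Within⇒Close {r = r} {x = x} here = Close-refl r (position (proj₁ x))
Within⇒Close {x = x} (step {y = y} a w) =
  Close-trans (AdjV⇒Close (proj₁ x) (proj₁ y) a) (Within⇒Close w)

module _ {segs : List (ℕ × Bool)} where
  private
    N = totalLen segs
    G = PendantPath segs

  walk-up : ∀ {r c p} (c<N : c < N) (p<N : p < N) → c ≤ p → p ≤ c + r →
    Within G r (path c , c<N) (path p , p<N)
  walk-up {r} {c} c<N p<N c≤p p≤c+r with m≤n⇒m<n∨m≡n c≤p
  ... | inj₂ refl rewrite <-irrelevant c<N p<N = here
  ... | inj₁ c<p with r
  ...   | zero  = contradiction (≤-trans p≤c+r (≤-reflexive (+-identityʳ c))) (<⇒≱ c<p)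
  ...   | suc r = step {y = path (suc c) , ≤-trans (s≤s c<p) p<N} (inj₁ refl)
                    (walk-up _ p<N c<p (≤-trans p≤c+r (≤-reflexive (+-suc c r))))

  Close⇒Within : ∀ {r c p} (c<N : c < N) (p<N : p < N) → Close r c p →
    Within G r (path c , c<N) (path p , p<N)
  Close⇒Within {c = c} {p} c<N p<N (c≤p+r , p≤c+r) with ≤-total c p
  ... | inj₁ c≤p = walk-up c<N p<N c≤p p≤c+r
  ... | inj₂ p≤c = Within-sym AdjV-sym (walk-up p<N c<N p≤c c≤p+r)

-- Lower bound

ball-width : ∀ c r → suc (c + r) ∸ (c ∸ r) ≤ odd r
ball-width c r = m≤n+o⇒m∸n≤o (suc (c + r)) (c ∸ r) (begin
  suc (c + r)            ≤⟨ s≤s (+-monoˡ-≤ r (m≤n+m∸n c r)) ⟩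
  suc (r + (c ∸ r) + r)  ≡⟨ rearrange r (c ∸ r) ⟩
  c ∸ r + (2 * r + 1)    ∎)
  where
  open ≤-Reasoning
  rearrange : ∀ r d → suc (r + d + r) ≡ d + (2 * r + 1)
  rearrange = solve-∀

burningSeq-length-bound : ∀ segs {k} (xs : Vec (Σ Vtx (IsVtx segs)) k) →
  IsBurningSeq (PendantPath segs) k xs → totalLen segs ≤ k * k
burningSeq-length-bound segs {k} xs burns = begin
  N                           ≤⟨ intervals-cover-≤ a b N cover ⟩
  ∑[ i < k ] (b i ⊓ N ∸ a i)  ≤⟨ ∑-mono-≤ (λ i → ≤-trans (∸-monoˡ-≤ (a i) (m⊓n≤m (b i) N))
                                                          (ball-width (c i) (r i))) ⟩
  ∑[ i < k ] odd (r i)        ≡⟨ ∑-odd k ⟩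
  k * k                       ∎
  where
  open ≤-Reasoning
  N = totalLen segs
  c r a b : Fin k → ℕ
  c i = position (proj₁ (lookup xs i))
  r i = k ∸ suc (toℕ i)
  a i = c i ∸ r i
  b i = suc (c i + r i)
  cover : ∀ p → p < N → ∃ λ i → a i ≤ p × p < b i
  cover p p<N with burns (path p , p<N)
  ... | i , w = i , Close⇒∈interval (Within⇒Close w)

m*m≤n*n⇒m≤n : ∀ {m n} → m * m ≤ n * n → m ≤ n
m*m≤n*n⇒m≤n m²≤n² = ≮⇒≥ (λ n<m → <⇒≱ (*-mono-< n<m n<m) m²≤n²)

-- Tilings by odd pieces and the upper bound

-- Tiling segs R: the path of segs is cut into consecutive pieces with odd r vertices, r running
-- through R in order; a Q-segment may be cut into several pieces, a T-segment is a single piece.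
data Tiling : List (ℕ × Bool) → List ℕ → Set where
  []    : Tiling [] []
  cut   : ∀ {ℓ ss R} rs → sum (map odd rs) ≡ ℓ → Tiling ss R → Tiling ((ℓ , false) ∷ ss) (rs ++ R)
  whole : ∀ {ℓ ss R} r → odd r ≡ ℓ → Tiling ss R → Tiling ((ℓ , true) ∷ ss) (r ∷ R)

tiling-totalLen : ∀ {ss R} → Tiling ss R → totalLen ss ≡ sum (map odd R)
tiling-totalLen []                           = refl
tiling-totalLen (cut {ss = ss} {R} rs refl t) = begin
  sum (map odd rs) + totalLen ss      ≡⟨ cong (sum (map odd rs) +_) (tiling-totalLen t) ⟩
  sum (map odd rs) + sum (map odd R)  ≡⟨ sum-++ (map odd rs) (map odd R) ⟨
  sum (map odd rs ++ map odd R)       ≡⟨ cong sum (map-++ odd rs R) ⟨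
  sum (map odd (rs ++ R))             ∎
  where open ≡-Reasoning
tiling-totalLen (whole r refl t) = cong (odd r +_) (tiling-totalLen t)

centres : ℕ → List ℕ → List (ℕ × ℕ)
centres s []      = []
centres s (r ∷ R) = (r , s + r) ∷ centres (s + odd r) R

centres-++ : ∀ s rs R → centres s (rs ++ R) ≡ centres s rs ++ centres (s + sum (map odd rs)) R
centres-++ s []       R = cong (λ s′ → centres s′ R) (sym (+-identityʳ s))
centres-++ s (r ∷ rs) R = cong ((r , s + r) ∷_) (trans (centres-++ (s + odd r) rs R)
  (cong (λ s′ → centres (s + odd r) rs ++ centres s′ R) (+-assoc s (odd r) _)))

map-proj₁-centres : ∀ s R → map proj₁ (centres s R) ≡ R
map-proj₁-centres s []      = refl
map-proj₁-centres s (r ∷ R) = cong (r ∷_) (map-proj₁-centres (s + odd r) R)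

r<odd : ∀ r → r < odd r
r<odd r = ≤-trans (s≤s (m≤m+n r (r + 0))) (≤-reflexive (+-comm 1 (2 * r)))

centre-in-range : ∀ s R {r c} → (r , c) ∈ centres s R → c < s + sum (map odd R)
centre-in-range s (r ∷ R) (here refl) = +-monoʳ-< s (≤-trans (r<odd r) (m≤m+n (odd r) _))
centre-in-range s (r ∷ R) (there m)   =
  ≤-trans (centre-in-range (s + odd r) R m) (≤-reflexive (+-assoc s (odd r) _))

piece-Close : ∀ {s r p} → s ≤ p → p < s + odd r → Close r (s + r) p
piece-Close {s} {r} s≤p p<end = +-monoˡ-≤ r s≤p , s≤s⁻¹ (≤-trans p<end (≤-reflexive (end≡ s r)))
  where
  end≡ : ∀ s r → s + (2 * r + 1) ≡ suc (s + r + r)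
  end≡ = solve-∀

inner-Close : ∀ {s r p} → s < p → suc p < s + odd (suc r) → Close r (s + suc r) p
inner-Close {s} {r} s<p p<end =
  ≤-trans (≤-reflexive (+-suc s r)) (+-monoˡ-≤ r s<p) ,
  s≤s⁻¹ (s≤s⁻¹ (≤-trans p<end (≤-reflexive (end≡ s r))))
  where
  end≡ : ∀ s r → s + (2 * suc r + 1) ≡ suc (suc (s + suc r + r))
  end≡ = solve-∀

path-cover : ∀ s R {p} → s ≤ p → p < s + sum (map odd R) →
  ∃₂ λ r c → (r , c) ∈ centres s R × Close r c p
path-cover s []      s≤p p<end = contradiction (≤-trans (≤-reflexive (+-identityʳ s)) s≤p) (<⇒≱ p<end)
path-cover s (r ∷ R) {p} s≤p p<end with p <? s + odd r
... | yes p<piece = r , s + r , here refl , piece-Close s≤p p<piece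
... | no  p≮piece with path-cover (s + odd r) R (≮⇒≥ p≮piece)
                         (≤-trans p<end (≤-reflexive (sym (+-assoc s (odd r) _))))
...   | r′ , c , m , close = r′ , c , there m , close

pendant-cover : ∀ {ss R} → Tiling ss R → ∀ s {p} → InnerT s ss p →
  ∃₂ λ r c → (suc r , c) ∈ centres s R × Close r c p
pendant-cover (cut rs e t) s (inj₁ (() , _))
pendant-cover (cut {ℓ} {R = R} rs refl t) s (inj₂ inner) with pendant-cover t (s + ℓ) inner
... | r , c , m , close = r , c , subst ((suc r , c) ∈_) (sym (centres-++ s rs R)) (∈-++⁺ʳ _ m) , close
pendant-cover (whole r refl t) s (inj₂ inner) with pendant-cover t (s + odd r) inner
... | r′ , c , m , close = r′ , c , there m , close
pendant-cover (whole zero    refl t) s (inj₁ (_ , s<p , p<end)) =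
  contradiction (≤-trans (n≤1+n _) (≤-trans p<end (≤-trans (≤-reflexive (+-comm s 1)) s<p))) 1+n≰n
pendant-cover (whole (suc r) refl t) s (inj₁ (_ , s<p , p<end)) =
  r , s + suc r , here refl , inner-Close s<p p<end

InnerT⇒< : ∀ s ss {p} → InnerT s ss p → p < s + totalLen ss
InnerT⇒< s ((ℓ , _) ∷ ss) (inj₁ (_ , _ , p<end)) =
  ≤-trans (n≤1+n _) (≤-trans p<end (≤-trans (m≤m+n (s + ℓ) _) (≤-reflexive (+-assoc s ℓ _))))
InnerT⇒< s ((ℓ , _) ∷ ss) (inj₂ inner) =
  ≤-trans (InnerT⇒< (s + ℓ) ss inner) (≤-reflexive (+-assoc s ℓ _))

∈-unique-key : ∀ {A B : Set} {L : List (A × B)} {k a b} → Unique (map proj₁ L) →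
  (k , a) ∈ L → (k , b) ∈ L → a ≡ b
∈-unique-key _        (here refl) (here refl) = refl
∈-unique-key (k∉ ∷ _) (here refl) (there m)   = contradiction refl (All.lookup k∉ (∈-map⁺ proj₁ m))
∈-unique-key (k∉ ∷ _) (there m)   (here refl) = contradiction refl (All.lookup k∉ (∈-map⁺ proj₁ m))
∈-unique-key (_  ∷ u) (there m)   (there m′)  = ∈-unique-key u m m′

tiling⇒burningSeq : ∀ {segs R} K → Tiling segs R → R ↭ downFrom K →
  Σ (Vec (Σ Vtx (IsVtx segs)) K) (IsBurningSeq (PendantPath segs) K)
tiling⇒burningSeq {segs} {R} K tiling R↭ = burningSeq-from-radii K source covers
  where
  G = PendantPath segs
  N = totalLen segs
  L = centres 0 R
  radii↭ : map proj₁ L ↭ downFrom K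
  radii↭ = subst (_↭ downFrom K) (sym (map-proj₁-centres 0 R)) R↭
  in-range : ∀ {r c} → (r , c) ∈ L → c < N
  in-range m = subst (_ <_) (sym (tiling-totalLen tiling)) (centre-in-range 0 R m)
  radius<K : ∀ {r c} → (r , c) ∈ L → r < K
  radius<K m = ∈-downFrom⁻ (∈-resp-↭ radii↭ (∈-map⁺ proj₁ m))
  centre : ∀ r → r < K → ∃ λ c → (r , c) ∈ L
  centre r r<K with ∈-map⁻ proj₁ (∈-resp-↭ (↭-sym radii↭) (∈-downFrom⁺ r<K))
  ... | (.r , c) , m , refl = c , m
  source : ∀ r → r < K → Graph.V G
  source r r<K = path (proj₁ (centre r r<K)) , in-range (proj₂ (centre r r<K))
  reaches : ∀ {r c d p} (m : (r , c) ∈ L) (p<N : p < N) → Close d c p →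
    Within G d (source r (radius<K m)) (path p , p<N)
  reaches {r} {c} {d} {p} m p<N close =
    Close⇒Within _ p<N (subst (λ c → Close d c p) (sym same-centre) close)
    where
    same-centre : proj₁ (centre r (radius<K m)) ≡ c
    same-centre = ∈-unique-key (Unique-resp-↭ (↭⇒↭ₛ (↭-sym radii↭)) (Unique.downFrom⁺ K))
                    (proj₂ (centre r (radius<K m))) m
  covers : ∀ v → ∃₂ λ r (r<K : r < K) → Within G r (source r r<K) v
  covers (path p , p<N) with path-cover 0 R z≤n (subst (p <_) (tiling-totalLen tiling) p<N)
  ... | r , c , m , close = r , radius<K m , reaches m p<N close
  covers (pend p , inner) with pendant-cover tiling 0 inner
  ... | r , c , m , close =
    suc r , radius<K m , Within-snoc (reaches m (InnerT⇒< 0 segs inner) close) refl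

⌊odd/2⌋ : ∀ r → ⌊ odd r /2⌋ ≡ r
⌊odd/2⌋ zero    = refl
⌊odd/2⌋ (suc r) = trans (cong ⌊_/2⌋ (odd-suc r)) (cong suc (⌊odd/2⌋ r))
  where
  odd-suc : ∀ r → 2 * suc r + 1 ≡ suc (suc (2 * r + 1))
  odd-suc = solve-∀

odd-injective : ∀ {a b} → odd a ≡ odd b → a ≡ b
odd-injective {a} {b} e = trans (sym (⌊odd/2⌋ a)) (trans (cong ⌊_/2⌋ e) (⌊odd/2⌋ b))

odd≢0 : ∀ r → odd r ≢ 0
odd≢0 r e = 1+n≢0 (trans (+-comm 1 (2 * r)) e)

map-⌊/2⌋-odd : ∀ rs → map ⌊_/2⌋ (map odd rs) ≡ rs
map-⌊/2⌋-odd []       = refl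
map-⌊/2⌋-odd (r ∷ rs) = cong₂ _∷_ (⌊odd/2⌋ r) (map-⌊/2⌋-odd rs)

Odd : ℕ → Set
Odd ℓ = odd ⌊ ℓ /2⌋ ≡ ℓ

odd-Odd : ∀ r → Odd (odd r)
odd-Odd r = cong odd (⌊odd/2⌋ r)

whole-all : ∀ ts → Tiling (map (λ t → t , true) (map odd ts)) ts
whole-all []       = []
whole-all (t ∷ ts) = whole t refl (whole-all ts)

tiling-interleave : ∀ {qs rss} → Pointwise (λ q rs → sum (map odd rs) ≡ q) qs rss → ∀ ts →
  ∃ λ R → Tiling (interleave qs (map odd ts)) R × R ↭ concat rss ++ ts
tiling-interleave [] ts = ts , whole-all ts , ↭-refl
tiling-interleave (_∷_ {y = rs} {ys = rss} e pw) [] with tiling-interleave pw []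
... | R , t , R↭ = rs ++ R , cut rs e t , (begin
      rs ++ R                 ↭⟨ ++⁺ˡ rs R↭ ⟩
      rs ++ concat rss ++ []  ≡⟨ ++-assoc rs (concat rss) [] ⟨
      (rs ++ concat rss) ++ [] ∎)
  where open PermutationReasoning
tiling-interleave (_∷_ {y = rs} {ys = rss} e pw) (t ∷ ts) with tiling-interleave pw ts
... | R , tl , R↭ = rs ++ t ∷ R , cut rs e (whole t refl tl) , (begin
      rs ++ t ∷ R                   ↭⟨ ++⁺ˡ rs (prep t R↭) ⟩
      rs ++ t ∷ concat rss ++ ts    ↭⟨ ++⁺ˡ rs (↭-sym (shift t (concat rss) ts)) ⟩
      rs ++ concat rss ++ t ∷ ts    ≡⟨ ++-assoc rs (concat rss) (t ∷ ts) ⟨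
      (rs ++ concat rss) ++ t ∷ ts  ∎)
  where open PermutationReasoning

halve-pieces : ∀ {qs lss} → Pointwise (λ q ls → sum ls ≡ q) qs lss → All Odd (concat lss) →
  Pointwise (λ q rs → sum (map odd rs) ≡ q) qs (map (map ⌊_/2⌋) lss)
halve-pieces []                     _    = []
halve-pieces (_∷_ {y = ls} e pieces) odds =
  trans (cong sum (trans (sym (map-∘ ls)) (map-id-local (All.++⁻ˡ ls odds)))) e
  ∷ halve-pieces pieces (All.++⁻ʳ ls odds)

downFrom-+ : ∀ j m → downFrom (j + m) ≡ applyUpTo (λ i → j + m ∸ suc i) j ++ downFrom m
downFrom-+ zero    m = refl
downFrom-+ (suc j) m = cong (j + m ∷_) (downFrom-+ j m)

T-radii : ℕ → List ℕ
T-radii m = applyUpTo (2 * m ∸_) (suc m)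

Tlens≡map-odd-T-radii : ∀ m → Tlens m ≡ map odd (T-radii m)
Tlens≡map-odd-T-radii m = trans (map-upTo _ (suc m)) (sym (map-applyUpTo (2 * m ∸_) odd (suc m)))

downFrom-2m+1 : ∀ m → downFrom (2 * m + 1) ≡ T-radii m ++ downFrom m
downFrom-2m+1 m = begin
  downFrom (2 * m + 1)                        ≡⟨ cong downFrom (2m+1≡ m) ⟩
  downFrom (suc m + m)                        ≡⟨ downFrom-+ (suc m) m ⟩
  applyUpTo (m + m ∸_) (suc m) ++ downFrom m  ≡⟨ cong (λ k → applyUpTo (k ∸_) (suc m) ++ downFrom m)
                                                      (cong (m +_) (sym (+-identityʳ m))) ⟩
  T-radii m ++ downFrom m                     ∎
  where
  open ≡-Reasoning
  2m+1≡ : ∀ m → 2 * m + 1 ≡ suc m + m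
  2m+1≡ = solve-∀

∈⇒≤maxL : ∀ {a} X → a ∈ X → a ≤ maxL X
∈⇒≤maxL (x ∷ X) (here refl) = m≤m⊔n x (maxL X)
∈⇒≤maxL (x ∷ X) (there a∈X) = ≤-trans (∈⇒≤maxL X a∈X) (m≤n⊔m x (maxL X))

2[1+a]∸1≡odd : ∀ a → 2 * suc a ∸ 1 ≡ odd a
2[1+a]∸1≡odd a = trans (+-suc a (a + 0)) (+-comm 1 (2 * a))

2a∸1-injective : ∀ {a b} → 2 * a ∸ 1 ≡ 2 * b ∸ 1 → a ≡ b
2a∸1-injective {zero}  {zero}  e = refl
2a∸1-injective {zero}  {suc b} e = contradiction (sym (trans e (2[1+a]∸1≡odd b))) (odd≢0 b)
2a∸1-injective {suc a} {zero}  e = contradiction (trans (sym (2[1+a]∸1≡odd a)) e) (odd≢0 a)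
2a∸1-injective {suc a} {suc b} e =
  cong suc (odd-injective (trans (sym (2[1+a]∸1≡odd a)) (trans e (2[1+a]∸1≡odd b))))

X′⊆odds : ∀ X → All (0 <_) X → ∀ {x} → x ∈ X′ X → x ∈ map odd (downFrom (maxL X))
X′⊆odds X positive x∈X′ with ∈-map⁻ (λ a → 2 * a ∸ 1) x∈X′
... | a , a∈X , refl with All.lookup positive a∈X
... | s≤s {n = a′} _ = subst (_∈ map odd (downFrom (maxL X))) (sym (2[1+a]∸1≡odd a′))
                          (∈-map⁺ odd (∈-downFrom⁺ (∈⇒≤maxL X a∈X)))

-- Both sides are duplicate-free lists with the same elements.
X′++Ylist↭odds : ∀ X → Unique X → All (0 <_) X → X′ X ++ Ylist X ↭ map odd (downFrom (maxL X))
X′++Ylist↭odds X unique positive = ∼bag⇒↭ (unique∧set⇒bag unique-X′++Y unique-odds (mk⇔ to from))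
  where
  odds = map odd (downFrom (maxL X))
  ∉X′? = λ y → ¬? (y ∈? X′ X)
  unique-odds : Unique odds
  unique-odds = Unique.map⁺ odd-injective (Unique.downFrom⁺ (maxL X))
  unique-X′++Y : Unique (X′ X ++ Ylist X)
  unique-X′++Y = Unique.++⁺ (Unique.map⁺ 2a∸1-injective unique) (Unique.filter⁺ ∉X′? unique-odds)
                   (λ (x∈X′ , x∈Y) → proj₂ (∈-filter⁻ ∉X′? {xs = odds} x∈Y) x∈X′)
  to : ∀ {x} → x ∈ X′ X ++ Ylist X → x ∈ odds
  to x∈ with ∈-++⁻ (X′ X) x∈
  ... | inj₁ x∈X′ = X′⊆odds X positive x∈X′
  ... | inj₂ x∈Y  = proj₁ (∈-filter⁻ ∉X′? {xs = odds} x∈Y)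
  from : ∀ {x} → x ∈ odds → x ∈ X′ X ++ Ylist X
  from {x} x∈odds with x ∈? X′ X
  ... | yes x∈X′ = ∈-++⁺ˡ x∈X′
  ... | no  x∉X′ = ∈-++⁺ʳ (X′ X) (∈-filter⁺ ∉X′? x∈odds x∉X′)

tripleList : ℕ × ℕ × ℕ → List ℕ
tripleList (a , b , c) = a ∷ b ∷ c ∷ []

concat-tripleList : ∀ ts → concat (map tripleList ts) ≡ flattenTriples ts
concat-tripleList []                 = refl
concat-tripleList ((a , b , c) ∷ ts) = cong (λ l → a ∷ b ∷ c ∷ l) (concat-tripleList ts)

triple-pieces : ∀ {n B′} (ts : Vec (ℕ × ℕ × ℕ) n) → All (λ t → tripleSum t ≡ B′) (toList ts) →
  Pointwise (λ q ls → sum ls ≡ q) (replicate n B′) (map tripleList (toList ts))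
triple-pieces []ᵥ                 []       = []
triple-pieces ((a , b , c) ∷ᵥ ts) (e ∷ es) = trans (sum-three a b c) e ∷ triple-pieces ts es
  where
  sum-three : ∀ a b c → a + (b + (c + 0)) ≡ a + b + c
  sum-three = solve-∀

singleton-pieces : ∀ ys → Pointwise (λ q ls → sum ls ≡ q) ys (map [_] ys)
singleton-pieces []       = []
singleton-pieces (y ∷ ys) = +-identityʳ y ∷ singleton-pieces ys

segments-tiling : ∀ {n} B X → Unique X → All (0 <_) X → (ts : Vec (ℕ × ℕ × ℕ) n) →
  flattenTriples (toList ts) ↭ X′ X → All (λ t → tripleSum t ≡ 2 * B ∸ 3) (toList ts) →
  ∃ λ R → Tiling (segments n B X) R × R ↭ downFrom (2 * maxL X + 1)
segments-tiling {n} B X unique positive ts flat↭X′ sums =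
  R , subst (λ T → Tiling (interleave Qs T) R) (sym (Tlens≡map-odd-T-radii m)) tiling , (begin
    R                                              ↭⟨ R↭ ⟩
    concat (map (map ⌊_/2⌋) lss) ++ T-radii m      ≡⟨ cong (_++ T-radii m) (concat-map lss) ⟩
    map ⌊_/2⌋ (concat lss) ++ T-radii m            ↭⟨ ++⁺ʳ (T-radii m) (Perm.map⁺ ⌊_/2⌋ pieces↭odds) ⟩
    map ⌊_/2⌋ (map odd (downFrom m)) ++ T-radii m  ≡⟨ cong (_++ T-radii m) (map-⌊/2⌋-odd (downFrom m)) ⟩
    downFrom m ++ T-radii m                        ↭⟨ ++-comm (downFrom m) (T-radii m) ⟩
    T-radii m ++ downFrom m                        ≡⟨ downFrom-2m+1 m ⟨
    downFrom (2 * m + 1)                           ∎)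
  where
  open PermutationReasoning
  m   = maxL X
  Y   = Ylist X
  Qs  = replicate n (2 * B ∸ 3) ++ Y
  lss = map tripleList (toList ts) ++ map [_] Y
  lengths : Pointwise (λ q ls → sum ls ≡ q) Qs lss
  lengths = Pointwise.++⁺ (triple-pieces ts sums) (singleton-pieces Y)
  pieces↭odds : concat lss ↭ map odd (downFrom m)
  pieces↭odds = begin
    concat lss                        ≡⟨ concat-++ (map tripleList (toList ts)) (map [_] Y) ⟨
    concat (map tripleList (toList ts)) ++ concat (map [_] Y)
                                      ≡⟨ cong₂ _++_ (concat-tripleList (toList ts)) (concat-map-[ Y ]) ⟩
    flattenTriples (toList ts) ++ Y   ↭⟨ ++⁺ʳ Y flat↭X′ ⟩
    X′ X ++ Y                         ↭⟨ X′++Ylist↭odds X unique positive ⟩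
    map odd (downFrom m)              ∎
  odd-pieces : All Odd (concat lss)
  odd-pieces = All-resp-↭ (↭-sym pieces↭odds) (All.map⁺ (All.universal odd-Odd _))
  pieces-tiling : ∃ λ R → Tiling (interleave Qs (map odd (T-radii m))) R
                    × R ↭ concat (map (map ⌊_/2⌋) lss) ++ T-radii m
  pieces-tiling = tiling-interleave (halve-pieces lengths odd-pieces) (T-radii m)
  R      = proj₁ pieces-tiling
  tiling = proj₁ (proj₂ pieces-tiling)
  R↭     = proj₂ (proj₂ pieces-tiling)

B<4a⇒0<a : ∀ {B a} → B < 4 * a → 0 < a
B<4a⇒0<a {a = suc a} _ = s≤s z≤n

-- Of the hypotheses on X only distinctness and B < 4a (i.e. a > 0) are needed, beside the partition.
lemma3 : (n B : ℕ) (X : List ℕ) →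
    1 ≤ n →
    length X ≡ 3 * n →
    Unique X →
    sum X ≡ n * B →
    All (λ a → B < 4 * a × 2 * a < B) X →
    (Σ (Vec (ℕ × ℕ × ℕ) n) λ ts →
        (flattenTriples (toList ts) ↭ X′ X)
      × All (λ t → tripleSum t ≡ 2 * B ∸ 3) (toList ts)) →
    BurningNumberIs (IG n B X) (2 * maxL X + 1)
lemma3 n B X _ _ unique _ bounds (ts , flat↭X′ , sums)
  with segments-tiling B X unique (All.map (B<4a⇒0<a ∘ proj₁) bounds) ts flat↭X′ sums
... | R , tiling , R↭ = tiling⇒burningSeq K tiling R↭ , minimal
  where
  K = 2 * maxL X + 1
  |P_I| : totalLen (segments n B X) ≡ K * K
  |P_I| = trans (tiling-totalLen tiling) (trans (sum-↭ (Perm.map⁺ odd R↭)) (sum-odd-downFrom K))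
  minimal : ∀ k xs → IsBurningSeq (IG n B X) k xs → K ≤ k
  minimal k xs burns = m*m≤n*n⇒m≤n (subst (_≤ k * k) |P_I| (burningSeq-length-bound _ xs burns))
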